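{- Let $G$ be a finite abelian group, $k\ge 0$ an integer, and $M$ a block matroid of rank $k+1$. If no $G$-labeling of $M$ is block isolating, then every $G$-labeling of $M$ is $k$-close.
   Context: Matroids are finite and loopless. A block matroid is a matroid whose ground set is the union of two disjoint bases (blocks). A $G$-labeling of $M=(E,\mathcal{I})$ is a map $\ell:E\to G$; $\ell(F)=\sum_{e\in F}\ell(e)$. A base $B$ is isolated under $\ell$ if it is the unique base $B'$ with $\ell(B')=\ell(B)$. A labeling is block isolating if it isolates some base whose complement $E\setminus B$ is also a base. A $g$-base is a base $B$ with $\ell(B)=g$. A $G$-labeling $\ell$ of $M$ is $k$-close if for every $g\in G$ for which a $g$-base exists, every base $A$ has a $g$-base $B$ with $|A\setminus B|\le k$. -}

module Defs where

open import Level using (Level; _⊔_)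
open import Data.Nat using (ℕ; zero; suc; _≤_; _<_)
open import Data.Fin using (Fin; zero) renaming (suc to fsuc)
open import Data.Fin.Subset using (Subset; ⊥; ⊤; ⁅_⁆; _∪_; _∩_; _─_; ∁; _⊆_; _∈_; _∉_; ∣_∣; inside; outside)
open import Data.Vec using (_∷_; [])
open import Data.Product using (Σ; ∃; _×_; _,_)
open import Relation.Nullary using (¬_)
open import Relation.Unary using (Decidable)
open import Relation.Binary.PropositionalEquality as ≡ using (_≡_)
open import Function.Bundles using (Bijection)
open import Algebra.Bundles using (AbelianGroup)

record Matroid (n : ℕ) : Set₁ where
  field
    Indep      : Subset n → Set
    indep?     : Decidable Indep            -- harmless: ground set is finite
    indep-⊥    : Indep ⊥
    indep-⊆    : ∀ {X Y} → X ⊆ Y → Indep Y → Indep X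
    augment    : ∀ {X Y} → Indep X → Indep Y → ∣ X ∣ < ∣ Y ∣ →
                 ∃ λ e → e ∈ Y × e ∉ X × Indep (⁅ e ⁆ ∪ X)

module _ {n : ℕ} (M : Matroid n) where
  open Matroid M

  IsBase : Subset n → Set
  IsBase B = Indep B × (∀ X → Indep X → B ⊆ X → X ≡ B)

  Loopless : Set
  Loopless = ∀ e → Indep ⁅ e ⁆

  HasRank : ℕ → Set
  HasRank r = ∃ λ B → IsBase B × ∣ B ∣ ≡ r

  IsBlockMatroid : Set
  IsBlockMatroid = ∃ λ B₁ → ∃ λ B₂ →
    IsBase B₁ × IsBase B₂ × (B₁ ∩ B₂ ≡ ⊥) × (B₁ ∪ B₂ ≡ ⊤)

module _ {c ℓ : Level} (G : AbelianGroup c ℓ) where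
  open AbelianGroup G

  IsFiniteGroup : Set (c ⊔ ℓ)
  IsFiniteGroup = ∃ λ m → Bijection setoid (≡.setoid (Fin m))

  labelSum : ∀ {n} → (Fin n → Carrier) → Subset n → Carrier
  labelSum {zero}  f []            = ε
  labelSum {suc n} f (inside ∷ p)  = f zero ∙ labelSum (λ i → f (fsuc i)) p
  labelSum {suc n} f (outside ∷ p) = labelSum (λ i → f (fsuc i)) p

  module _ {n : ℕ} (M : Matroid n) (lab : Fin n → Carrier) where

    Isolated : Subset n → Set ℓ
    Isolated B = IsBase M B ×
      (∀ B′ → IsBase M B′ → labelSum lab B′ ≈ labelSum lab B → B′ ≡ B)

    BlockIsolating : Set ℓ
    BlockIsolating = ∃ λ B → Isolated B × IsBase M (∁ B)

    IsGBase : Carrier → Subset n → Set ℓ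
    IsGBase g B = IsBase M B × labelSum lab B ≈ g

    Close : ℕ → Set (c ⊔ ℓ)
    Close k = ∀ g → (∃ λ B → IsGBase g B) →
      ∀ A → IsBase M A → ∃ λ B → IsGBase g B × ∣ A ─ B ∣ ≤ k

-- The rank r = k + 1 forces the ground set of a block matroid to have exactly 2r elements, so a
-- base A has exactly one base at distance r from it, namely its complement E ∖ A. Fix a label g
-- that some base attains. If no g-base were within distance k of A, every g-base would be at
-- distance r, hence equal to E ∖ A; then E ∖ A would be the unique g-base, with complement A a
-- base, and the labeling would be block isolating.
module Submission where

open import Defs
open import Level using (Level)
open import Data.Nat using (ℕ; suc; s≤s; _≤_; _∸_; _≤?_)
open import Data.Nat.Properties using (≤-reflexive; ≤-antisym; ≮⇒≥; ≰⇒>; <⇒≱; _≟_)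
open import Data.Fin using (Fin)
import Data.Fin.Properties as Fin
open import Data.Fin.Subset using (Subset; ⊥; ⊤; ⁅_⁆; _∪_; _∩_; _─_; ∁; _⊆_; _∈_; ∣_∣; inside; outside)
open import Data.Fin.Subset.Properties
  using ( _∈?_; ∉⊥; ∈⊤; x∈⁅x⁆; x∈p∪q⁺; x∈p∪q⁻; x∈p∩q⁺; x∉p⇒x∈∁p; x∈∁p⇒x∉p; q⊆p∪q
        ; ⊆-antisym; drop-∷-⊆; p⊆q⇒∣p∣≤∣q∣; ∣∁p∣≡n∸∣p∣; p∩q≢∅⇒∣p─q∣<∣p∣
        ; ∪-∩-booleanAlgebra; anySubset? )
import Algebra.Lattice.Properties.BooleanAlgebra as BooleanAlgebra
open import Data.Vec using ([]; _∷_; here)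
open import Data.Product using (_,_; proj₁)
open import Data.Sum using (inj₁; [_,_])
open import Function using (id)
open import Function.Bundles using (Bijection)
open import Relation.Nullary using (¬_; yes; no; contradiction)
open import Relation.Nullary.Decidable using (_×-dec_; map′)
open import Relation.Unary using (Decidable)
import Relation.Binary.Definitions as Binary
open import Relation.Binary.PropositionalEquality using (_≡_; refl; sym; trans; cong; subst; module ≡-Reasoning)
open import Algebra.Bundles using (AbelianGroup)

∁-involutive : ∀ {n} (p : Subset n) → ∁ (∁ p) ≡ p
∁-involutive {n} = ¬-involutive
  where open BooleanAlgebra (∪-∩-booleanAlgebra n) using (¬-involutive)

p⊆q∧∣q∣≤∣p∣⇒p≡q : ∀ {n} {p q : Subset n} → p ⊆ q → ∣ q ∣ ≤ ∣ p ∣ → p ≡ q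
p⊆q∧∣q∣≤∣p∣⇒p≡q {p = []}          {[]}          _   _ = refl
p⊆q∧∣q∣≤∣p∣⇒p≡q {p = inside ∷ p}  {inside ∷ q}  p⊆q (s≤s ∣q∣≤∣p∣) =
  cong (inside ∷_) (p⊆q∧∣q∣≤∣p∣⇒p≡q (drop-∷-⊆ p⊆q) ∣q∣≤∣p∣)
p⊆q∧∣q∣≤∣p∣⇒p≡q {p = inside ∷ p}  {outside ∷ q} p⊆q _ with p⊆q here
... | ()
p⊆q∧∣q∣≤∣p∣⇒p≡q {p = outside ∷ p} {inside ∷ q}  p⊆q ∣q∣≤∣p∣ =
  contradiction ∣q∣≤∣p∣ (<⇒≱ (s≤s (p⊆q⇒∣p∣≤∣q∣ (drop-∷-⊆ p⊆q))))
p⊆q∧∣q∣≤∣p∣⇒p≡q {p = outside ∷ p} {outside ∷ q} p⊆q ∣q∣≤∣p∣ =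
  cong (outside ∷_) (p⊆q∧∣q∣≤∣p∣⇒p≡q (drop-∷-⊆ p⊆q) ∣q∣≤∣p∣)

p∩q≡⊥∧p∪q≡⊤⇒q≡∁p : ∀ {n} {p q : Subset n} → p ∩ q ≡ ⊥ → p ∪ q ≡ ⊤ → q ≡ ∁ p
p∩q≡⊥∧p∪q≡⊤⇒q≡∁p {p = p} {q} p∩q≡⊥ p∪q≡⊤ = ⊆-antisym q⊆∁p ∁p⊆q
  where
  q⊆∁p : q ⊆ ∁ p
  q⊆∁p {x} x∈q = x∉p⇒x∈∁p λ x∈p → ∉⊥ (subst (x ∈_) p∩q≡⊥ (x∈p∩q⁺ (x∈p , x∈q)))
  ∁p⊆q : ∁ p ⊆ q
  ∁p⊆q {x} x∈∁p = [ (λ x∈p → contradiction x∈p (x∈∁p⇒x∉p x∈∁p)) , id ]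
    (x∈p∪q⁻ p q (subst (x ∈_) (sym p∪q≡⊤) ∈⊤))

∣p∣≤∣p─q∣⇒q⊆∁p : ∀ {n} (p q : Subset n) → ∣ p ∣ ≤ ∣ p ─ q ∣ → q ⊆ ∁ p
∣p∣≤∣p─q∣⇒q⊆∁p p q ∣p∣≤∣p─q∣ {x} x∈q with x ∈? p
... | yes x∈p = contradiction ∣p∣≤∣p─q∣ (<⇒≱ (p∩q≢∅⇒∣p─q∣<∣p∣ p q (x , x∈p∩q⁺ (x∈p , x∈q))))
... | no x∉p  = x∉p⇒x∈∁p x∉p

module _ {n : ℕ} (M : Matroid n) where
  open Matroid M

  ∣indep∣≤∣base∣ : ∀ {B X} → IsBase M B → Indep X → ∣ X ∣ ≤ ∣ B ∣
  ∣indep∣≤∣base∣ {B} (indB , maxB) indX = ≮⇒≥ λ ∣B∣<∣X∣ →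
    let e , _ , e∉B , indeB = augment indB indX ∣B∣<∣X∣
        e∈eB = x∈p∪q⁺ (inj₁ (x∈⁅x⁆ e))
    in e∉B (subst (e ∈_) (maxB (⁅ e ⁆ ∪ B) indeB (q⊆p∪q ⁅ e ⁆ B)) e∈eB)

  ∣base∣≡∣base∣ : ∀ {B C} → IsBase M B → IsBase M C → ∣ B ∣ ≡ ∣ C ∣
  ∣base∣≡∣base∣ baseB baseC = ≤-antisym (∣indep∣≤∣base∣ baseC (proj₁ baseB)) (∣indep∣≤∣base∣ baseB (proj₁ baseC))

  indep∧∣∣≡∣base∣⇒base : ∀ {B₀ B} → IsBase M B₀ → Indep B → ∣ B ∣ ≡ ∣ B₀ ∣ → IsBase M B
  indep∧∣∣≡∣base∣⇒base baseB₀ indB ∣B∣≡∣B₀∣ = indB , λ X indX B⊆X →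
    sym (p⊆q∧∣q∣≤∣p∣⇒p≡q B⊆X (subst (∣ X ∣ ≤_) (sym ∣B∣≡∣B₀∣) (∣indep∣≤∣base∣ baseB₀ indX)))

  isBase? : ∀ {B₀} → IsBase M B₀ → Decidable (IsBase M)
  isBase? {B₀} baseB₀ B = map′
    (λ (indB , ∣B∣≡∣B₀∣) → indep∧∣∣≡∣base∣⇒base baseB₀ indB ∣B∣≡∣B₀∣)
    (λ baseB → proj₁ baseB , ∣base∣≡∣base∣ baseB baseB₀)
    (indep? B ×-dec ∣ B ∣ ≟ ∣ B₀ ∣)

  ∣∁base∣≡∣base∣ : IsBlockMatroid M → ∀ {A C} → IsBase M A → IsBase M C → ∣ ∁ A ∣ ≡ ∣ C ∣
  ∣∁base∣≡∣base∣ (B₁ , B₂ , baseB₁ , baseB₂ , B₁∩B₂≡⊥ , B₁∪B₂≡⊤) {A} {C} baseA baseC = begin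
    ∣ ∁ A ∣    ≡⟨ ∣∁p∣≡n∸∣p∣ A ⟩
    n ∸ ∣ A ∣  ≡⟨ cong (n ∸_) (∣base∣≡∣base∣ baseA baseB₁) ⟩
    n ∸ ∣ B₁ ∣ ≡⟨ sym (∣∁p∣≡n∸∣p∣ B₁) ⟩
    ∣ ∁ B₁ ∣   ≡⟨ cong ∣_∣ (sym (p∩q≡⊥∧p∪q≡⊤⇒q≡∁p B₁∩B₂≡⊥ B₁∪B₂≡⊤)) ⟩
    ∣ B₂ ∣     ≡⟨ ∣base∣≡∣base∣ baseB₂ baseC ⟩
    ∣ C ∣      ∎
    where open ≡-Reasoning

  ∣A∣≤∣A─C∣⇒C≡∁A : IsBlockMatroid M → ∀ {A C} → IsBase M A → IsBase M C →
                   ∣ A ∣ ≤ ∣ A ─ C ∣ → C ≡ ∁ A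
  ∣A∣≤∣A─C∣⇒C≡∁A block {A} {C} baseA baseC ∣A∣≤∣A─C∣ =
    p⊆q∧∣q∣≤∣p∣⇒p≡q (∣p∣≤∣p─q∣⇒q⊆∁p A C ∣A∣≤∣A─C∣)
                    (≤-reflexive (∣∁base∣≡∣base∣ block baseA baseC))

module _ {c ℓ : Level} (G : AbelianGroup c ℓ) where
  open AbelianGroup G using (Carrier; _≈_) renaming (trans to ≈-trans)

  finite⇒≈-decidable : IsFiniteGroup G → Binary.Decidable _≈_
  finite⇒≈-decidable (_ , bij) x y =
    map′ (Bijection.injective bij) (Bijection.cong bij) (Bijection.to bij x Fin.≟ Bijection.to bij y)

  module _ {n : ℕ} (M : Matroid n) (lab : Fin n → Carrier) where

    isGBase? : IsFiniteGroup G → ∀ {B₀} → IsBase M B₀ → ∀ g → Decidable (IsGBase G M lab g)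
    isGBase? finite baseB₀ g B = isBase? M baseB₀ B ×-dec finite⇒≈-decidable finite (labelSum G lab B) g

    far-gBases⇒blockIsolating : IsBlockMatroid M → ∀ {g A B} → IsBase M A → IsGBase G M lab g B →
                                (∀ C → IsGBase G M lab g C → ∣ A ∣ ≤ ∣ A ─ C ∣) →
                                BlockIsolating G M lab
    far-gBases⇒blockIsolating block {g} {A} {B} baseA gB@(baseB , ∑B≈g) far =
      B , (baseB , isolated) , subst (IsBase M) (sym ∁B≡A) baseA
      where
      gBase≡∁A : ∀ {C} → IsGBase G M lab g C → C ≡ ∁ A
      gBase≡∁A {C} gC = ∣A∣≤∣A─C∣⇒C≡∁A M block baseA (proj₁ gC) (far C gC)

      isolated : ∀ B′ → IsBase M B′ → labelSum G lab B′ ≈ labelSum G lab B → B′ ≡ B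
      isolated B′ baseB′ ∑B′≈∑B = trans (gBase≡∁A (baseB′ , ≈-trans ∑B′≈∑B ∑B≈g)) (sym (gBase≡∁A gB))

      ∁B≡A : ∁ B ≡ A
      ∁B≡A = trans (cong ∁ (gBase≡∁A gB)) (∁-involutive A)

proposition1 : ∀ {c ℓ : Level} (G : AbelianGroup c ℓ) → IsFiniteGroup G →
    (k : ℕ) {n : ℕ} (M : Matroid n) → Loopless M → IsBlockMatroid M →
    HasRank M (suc k) →
    (∀ (lab : Fin n → AbelianGroup.Carrier G) → ¬ BlockIsolating G M lab) →
    ∀ (lab : Fin n → AbelianGroup.Carrier G) → Close G M lab k
proposition1 G finite k M _ block (B₀ , baseB₀ , ∣B₀∣≡1+k) notBlockIsolating lab g (B , gB) A baseA
  -- Finiteness of G serves only to make this search decidable.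
  with anySubset? (λ C → isGBase? G M lab finite baseB₀ g C ×-dec ∣ A ─ C ∣ ≤? k)
... | yes closeGBase  = closeGBase
... | no ∄closeGBase = contradiction (far-gBases⇒blockIsolating G M lab block baseA gB far) (notBlockIsolating lab)
  where
  far : ∀ C → IsGBase G M lab g C → ∣ A ∣ ≤ ∣ A ─ C ∣
  far C gC = subst (_≤ ∣ A ─ C ∣) (sym (trans (∣base∣≡∣base∣ M baseA baseB₀) ∣B₀∣≡1+k))
                   (≰⇒> λ close → ∄closeGBase (C , gC , close))
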